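{- Let $w=w_1w_2\cdots w_n$ be a word of length $n\ge 2$ over an alphabet $\Sigma$ (with $w_i\in\Sigma$) such that $w_1\ne w_n$. Then $SP_{n-2}(w)\le 2$ if $n$ is even and $SP_{n-2}(w)\le 4$ if $n$ is odd.
   Context: A scattered subword of $w$ is a (not necessarily contiguous) subsequence of $w$. A palindrome is a word equal to its reversal. For $t\ge 0$, $SP_t(w)$ is the number of distinct palindromes of length $t$ that are scattered subwords of $w$. -}

module Defs where

open import Data.List using (List; length; reverse)
open import Data.List.Relation.Binary.Sublist.Propositional using (_⊆_)
open import Data.List.Relation.Unary.All using (All)
open import Data.List.Relation.Unary.Unique.Propositional using (Unique)
open import Data.Nat using (ℕ; _≤_)
open import Data.Product using (_×_)
open import Relation.Binary.PropositionalEquality using (_≡_)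

ScatteredSubword : {A : Set} → List A → List A → Set
ScatteredSubword u w = u ⊆ w

IsPalindrome : {A : Set} → List A → Set
IsPalindrome u = reverse u ≡ u

SPmember : {A : Set} → ℕ → List A → List A → Set
SPmember t w u = IsPalindrome u × length u ≡ t × ScatteredSubword u w

SP≤ : {A : Set} → ℕ → List A → ℕ → Set
SP≤ {A} t w k = (ps : List (List A)) → Unique ps → All (SPmember t w) ps → length ps ≤ k

-- A palindrome of length n − 2 inside w = a k b cannot keep both end letters, as a ≠ b, so it
-- is obtained from ak or from kb by deleting one letter. A word v has at most one palindromic
-- one-letter deletion when |v| is odd and at most two when |v| is even. If v = x k x with k
-- nonempty, these deletions are the words x u x with u a palindromic deletion of k, and we
-- recurse. If v = x k y with x ≠ y, the only candidates are k y and x k; when |k| is odd they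
-- are not both palindromes, for then x k y would have period 2 and odd length, forcing x = y.
module Submission where

open import Defs
open import Data.List using (List; []; _∷_; _++_; [_]; length; head; last; reverse; map; initLast; _∷ʳ′_)
open import Data.List.Properties using (length-map; unfold-reverse; reverse-++; ∷-injective; ∷ʳ-injective)
open import Data.List.Relation.Binary.Equality.Propositional using (≋⇒≡)
open import Data.List.Relation.Binary.Sublist.Propositional using (_⊆_; []; _∷_; _∷ʳ_; ⊆-refl)
open import Data.List.Relation.Binary.Sublist.Propositional.Properties using (All-resp-⊆; to-≋; ++⁺ʳ)
open import Data.List.Relation.Unary.All as All using (All; []; _∷_)
open import Data.List.Relation.Unary.AllPairs using ([]; _∷_)
open import Data.List.Relation.Unary.Unique.Propositional using (Unique)
open import Data.List.Relation.Unary.Unique.Propositional.Properties using (map⁻)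
open import Data.Maybe using (just)
open import Data.Maybe.Properties using (just-injective)
open import Data.Nat using (ℕ; zero; suc; _+_; _*_; _∸_; _≤_; z≤n; s≤s)
open import Data.Nat.Properties using (_≤?_; +-mono-≤; +-suc; *-suc; suc-injective; module ≤-Reasoning)
open import Data.Product using (Σ-syntax; ∃-syntax; _×_; _,_; proj₁)
open import Data.Sum using (_⊎_; inj₁; inj₂)
open import Function using (id)
open import Relation.Nullary using (¬_; yes; no; contradiction)
open import Relation.Nullary.Decidable.Core using (decidable-stable; ¬¬-excluded-middle)
open import Relation.Binary.PropositionalEquality using (_≡_; _≢_; refl; sym; trans; cong; subst; module ≡-Reasoning)

private variable
  A B C : Set
  x y : A
  k u u′ v : List A
  m n : ℕ

AtMost : (B → Set) → ℕ → Set
AtMost {B} P n = (ps : List B) → Unique ps → All P ps → length ps ≤ n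

Unique-resp-⊆ : {xs ys : List B} → xs ⊆ ys → Unique ys → Unique xs
Unique-resp-⊆ [] [] = []
Unique-resp-⊆ (_ ∷ʳ τ) (_ ∷ ys!) = Unique-resp-⊆ τ ys!
Unique-resp-⊆ (refl ∷ τ) (y∉ys ∷ ys!) = All-resp-⊆ τ y∉ys ∷ Unique-resp-⊆ τ ys!

partition-⊎ : {P Q : B → Set} {ps : List B} → All (λ u → P u ⊎ Q u) ps →
  Σ[ qs ∈ List B ] Σ[ rs ∈ List B ]
    (qs ⊆ ps × All P qs) × (rs ⊆ ps × All Q rs) × length ps ≡ length qs + length rs
partition-⊎ [] = [] , [] , ([] , []) , ([] , []) , refl
partition-⊎ (inj₁ Pp ∷ h) with partition-⊎ h
... | qs , rs , (qs⊆ , Pqs) , (rs⊆ , Qrs) , e =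
  _ ∷ qs , rs , (refl ∷ qs⊆ , Pp ∷ Pqs) , (_ ∷ʳ rs⊆ , Qrs) , cong suc e
partition-⊎ (inj₂ Qp ∷ h) with partition-⊎ h
... | qs , rs , (qs⊆ , Pqs) , (rs⊆ , Qrs) , e =
  qs , _ ∷ rs , (_ ∷ʳ qs⊆ , Pqs) , (refl ∷ rs⊆ , Qp ∷ Qrs) , trans (cong suc e) (sym (+-suc _ _))

preimages : {P : B → Set} {Q : C → Set} (f : C → B) → (∀ {u} → P u → ∃[ u′ ] Q u′ × u ≡ f u′) →
  {ps : List B} → All P ps → ∃[ qs ] All Q qs × map f qs ≡ ps
preimages f h [] = [] , [] , refl
preimages f h (Pp ∷ Pps) with h Pp | preimages f h Pps
... | q , Qq , refl | qs , Qqs , refl = q ∷ qs , Qq ∷ Qqs , refl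

module _ {P : B → Set} where

  atMost-empty : {n : ℕ} → (∀ {u} → ¬ P u) → AtMost P n
  atMost-empty ¬P [] _ _ = z≤n
  atMost-empty ¬P (_ ∷ _) _ (Pp ∷ _) = contradiction Pp ¬P

  atMost-subsingleton : (∀ {u v} → P u → P v → u ≡ v) → AtMost P 1
  atMost-subsingleton eq [] _ _ = z≤n
  atMost-subsingleton eq (_ ∷ []) _ _ = s≤s z≤n
  atMost-subsingleton eq (_ ∷ _ ∷ _) ((p≢q ∷ _) ∷ _) (Pp ∷ Pq ∷ _) = contradiction (eq Pp Pq) p≢q

  atMost-singleton : (c : B) → (∀ {u} → P u → u ≡ c) → AtMost P 1
  atMost-singleton c eq = atMost-subsingleton λ Pu Pv → trans (eq Pu) (sym (eq Pv))

  atMost-∪ : {Q R : B → Set} {m n : ℕ} → (∀ {u} → P u → Q u ⊎ R u) →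
    AtMost Q m → AtMost R n → AtMost P (m + n)
  atMost-∪ {m = m} {n} split Q≤m R≤n ps ps! Pps with partition-⊎ (All.map split Pps)
  ... | qs , rs , (qs⊆ , Qqs) , (rs⊆ , Rrs) , e = begin
    length ps               ≡⟨ e ⟩
    length qs + length rs   ≤⟨ +-mono-≤ (Q≤m qs (Unique-resp-⊆ qs⊆ ps!) Qqs) (R≤n rs (Unique-resp-⊆ rs⊆ ps!) Rrs) ⟩
    m + n                   ∎
    where open ≤-Reasoning

  atMost-image : {Q : C → Set} {n : ℕ} (f : C → B) → (∀ {u} → P u → ∃[ u′ ] Q u′ × u ≡ f u′) →
    AtMost Q n → AtMost P n
  atMost-image f h Q≤n ps ps! Pps with preimages f h Pps
  ... | qs , Qqs , refl = subst (_≤ _) (sym (length-map f qs)) (Q≤n qs (map⁻ ps!) Qqs)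

  -- Equality on the alphabet need not be decidable, but a bound is a decidable statement,
  -- so it may be proved by cases on an arbitrary proposition.
  atMost-byCases : {n : ℕ} (X : Set) → (X → AtMost P n) → (¬ X → AtMost P n) → AtMost P n
  atMost-byCases {n} X yes-case no-case ps ps! Pps = decidable-stable (length ps ≤? n) λ ¬bound →
    ¬¬-excluded-middle {A = X} λ where
      (yes x) → ¬bound (yes-case x ps ps! Pps)
      (no ¬x) → ¬bound (no-case ¬x ps ps! Pps)

length-++-[] : (xs : List A) → length (xs ++ [ y ]) ≡ suc (length xs)
length-++-[] [] = refl
length-++-[] (_ ∷ xs) = cong suc (length-++-[] xs)

last-++-[] : (xs : List A) → last (xs ++ [ y ]) ≡ just y
last-++-[] [] = refl
last-++-[] (_ ∷ []) = refl
last-++-[] (_ ∷ x ∷ xs) = last-++-[] (x ∷ xs)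

split-ends : (v : List A) → length v ≡ suc (suc n) →
  ∃[ x ] ∃[ k ] ∃[ y ] v ≡ x ∷ k ++ [ y ] × length k ≡ n
split-ends (x ∷ v) |v| with initLast v
split-ends (x ∷ .[]) () | []
... | k ∷ʳ′ y = x , k , y , refl , suc-injective (trans (sym (length-++-[] k)) (suc-injective |v|))

⊆-length-≡ : {xs ys : List A} → xs ⊆ ys → length xs ≡ length ys → xs ≡ ys
⊆-length-≡ xs⊆ys e = ≋⇒≡ (to-≋ e xs⊆ys)

⊆-++-[]⁻ : u ⊆ k ++ [ y ] → u ⊆ k ⊎ ∃[ u′ ] u ≡ u′ ++ [ y ] × u′ ⊆ k
⊆-++-[]⁻ {k = []} (_ ∷ʳ []) = inj₁ []
⊆-++-[]⁻ {k = []} (refl ∷ []) = inj₂ ([] , refl , [])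
⊆-++-[]⁻ {k = z ∷ k} (_ ∷ʳ u⊆) with ⊆-++-[]⁻ u⊆
... | inj₁ u⊆k = inj₁ (z ∷ʳ u⊆k)
... | inj₂ (u′ , e , u′⊆k) = inj₂ (u′ , e , z ∷ʳ u′⊆k)
⊆-++-[]⁻ {k = z ∷ k} (refl ∷ u⊆) with ⊆-++-[]⁻ u⊆
... | inj₁ u⊆k = inj₁ (refl ∷ u⊆k)
... | inj₂ (u′ , refl , u′⊆k) = inj₂ (z ∷ u′ , refl , refl ∷ u′⊆k)

reverse-wrap : (x : A) (k : List A) (y : A) → reverse (x ∷ k ++ [ y ]) ≡ y ∷ reverse k ++ [ x ]
reverse-wrap x k y = trans (unfold-reverse x (k ++ [ y ])) (cong (_++ [ x ]) (reverse-++ k [ y ]))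

palindrome-peel : (x : A) (k : List A) (y : A) → IsPalindrome (x ∷ k ++ [ y ]) → x ≡ y × IsPalindrome k
palindrome-peel x k y pal with ∷-injective (trans (sym (reverse-wrap x k y)) pal)
... | y≡x , rev-k++x≡k++y = sym y≡x , proj₁ (∷ʳ-injective (reverse k) k rev-k++x≡k++y)

palindrome-∷⁻ : k ≢ [] → IsPalindrome (x ∷ k) → ∃[ k′ ] k ≡ k′ ++ [ x ] × IsPalindrome k′
palindrome-∷⁻ {k = k} {x} k≢[] pal with initLast k
... | [] = contradiction refl k≢[]
... | k′ ∷ʳ′ z with palindrome-peel x k′ z pal
...   | refl , pal′ = k′ , refl , pal′

palindrome-++-[]⁻ : k ≢ [] → IsPalindrome (k ++ [ x ]) → ∃[ k′ ] k ≡ x ∷ k′ × IsPalindrome k′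
palindrome-++-[]⁻ {k = []} k≢[] pal = contradiction refl k≢[]
palindrome-++-[]⁻ {k = z ∷ k′} {x} k≢[] pal with palindrome-peel z k′ x pal
... | refl , pal′ = k′ , refl , pal′

palindrome-ends-odd : (m : ℕ) (x : A) (k : List A) (y : A) → length k ≡ suc (2 * m) →
  IsPalindrome (x ∷ k) → IsPalindrome (k ++ [ y ]) → x ≡ y
palindrome-ends-odd zero x (z ∷ []) y _ palˡ palʳ =
  trans (proj₁ (palindrome-peel x [] z palˡ)) (proj₁ (palindrome-peel z [] y palʳ))
palindrome-ends-odd (suc m) x k y |k| palˡ palʳ with split-ends k (trans |k| (cong suc (*-suc 2 m)))
... | z , k′ , t , refl , |k′| with palindrome-peel x (z ∷ k′) t palˡ | palindrome-peel z (k′ ++ [ t ]) y palʳ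
...   | x≡t , palˡ′ | z≡y , palʳ′ = trans x≡t (trans (sym (palindrome-ends-odd m z k′ t |k′| palˡ′ palʳ′)) z≡y)

PalindromicDeletion : List A → List A → Set
PalindromicDeletion v u = IsPalindrome u × u ⊆ v × suc (length u) ≡ length v

palindromicDeletion-cases : PalindromicDeletion (x ∷ k ++ [ y ]) u →
  u ≡ k ++ [ y ] ⊎ u ≡ x ∷ k ⊎ (x ≡ y × ∃[ u′ ] PalindromicDeletion k u′ × u ≡ x ∷ u′ ++ [ y ])
palindromicDeletion-cases (_ , _ ∷ʳ u⊆ , |u|) =
  inj₁ (⊆-length-≡ u⊆ (suc-injective |u|))
palindromicDeletion-cases {x = x} {k} {y} (pal , refl ∷ u⊆ , |u|) with ⊆-++-[]⁻ u⊆
... | inj₁ u⊆k =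
  inj₂ (inj₁ (cong (x ∷_) (⊆-length-≡ u⊆k (suc-injective (trans (suc-injective |u|) (length-++-[] k))))))
... | inj₂ (u′ , refl , u′⊆k) with palindrome-peel x u′ y pal
...   | x≡y , pal′ = inj₂ (inj₂ (x≡y , u′ , (pal′ , u′⊆k , |u′|) , refl))
  where
    |u′| : suc (length u′) ≡ length k
    |u′| = suc-injective (begin
      suc (suc (length u′))        ≡⟨ cong suc (sym (length-++-[] u′)) ⟩
      suc (length (u′ ++ [ y ]))   ≡⟨ suc-injective |u| ⟩
      length (k ++ [ y ])          ≡⟨ length-++-[] k ⟩
      suc (length k)               ∎)
      where open ≡-Reasoning

palindromicDeletion-inner : k ≢ [] → PalindromicDeletion (x ∷ k ++ [ x ]) u →
  ∃[ u′ ] PalindromicDeletion k u′ × u ≡ x ∷ u′ ++ [ x ]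
palindromicDeletion-inner {x = x} k≢[] d@(pal , _) with palindromicDeletion-cases d
... | inj₂ (inj₂ (_ , inner)) = inner
... | inj₁ refl with palindrome-++-[]⁻ k≢[] pal
...   | k′ , refl , pal′ = k′ , (pal′ , x ∷ʳ ⊆-refl , refl) , refl
palindromicDeletion-inner {x = x} k≢[] d@(pal , _) | inj₂ (inj₁ refl) with palindrome-∷⁻ k≢[] pal
...   | k′ , refl , pal′ = k′ , (pal′ , ++⁺ʳ [ x ] ⊆-refl , sym (length-++-[] k′)) , refl

palindromicDeletion-outer : (∀ {u′} → PalindromicDeletion k u′ → x ≢ y) →
  PalindromicDeletion (x ∷ k ++ [ y ]) u → u ≡ k ++ [ y ] ⊎ u ≡ x ∷ k
palindromicDeletion-outer no-inner d with palindromicDeletion-cases d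
... | inj₁ e = inj₁ e
... | inj₂ (inj₁ e) = inj₂ e
... | inj₂ (inj₂ (x≡y , _ , d′ , _)) = contradiction x≡y (no-inner d′)

palindromicDeletion-odd-unique : (m : ℕ) → x ≢ y → length k ≡ suc (2 * m) →
  PalindromicDeletion (x ∷ k ++ [ y ]) u → PalindromicDeletion (x ∷ k ++ [ y ]) u′ → u ≡ u′
palindromicDeletion-odd-unique {x = x} {y} {k} m x≢y |k| d d′
  with palindromicDeletion-outer (λ _ → x≢y) d | palindromicDeletion-outer (λ _ → x≢y) d′
... | inj₁ refl | inj₁ refl = refl
... | inj₂ refl | inj₂ refl = refl
... | inj₁ refl | inj₂ refl = contradiction (palindrome-ends-odd m x k y |k| (proj₁ d′) (proj₁ d)) x≢y
... | inj₂ refl | inj₁ refl = contradiction (palindrome-ends-odd m x k y |k| (proj₁ d) (proj₁ d′)) x≢y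

atMost-palindromicDeletion-wrap : k ≢ [] → AtMost (PalindromicDeletion k) n →
  AtMost (PalindromicDeletion (x ∷ k ++ [ x ])) n
atMost-palindromicDeletion-wrap {x = x} k≢[] = atMost-image (λ u′ → x ∷ u′ ++ [ x ]) (palindromicDeletion-inner k≢[])

atMost-palindromicDeletion-outer : (∀ {u′} → PalindromicDeletion k u′ → x ≢ y) →
  AtMost (PalindromicDeletion (x ∷ k ++ [ y ])) 2
atMost-palindromicDeletion-outer {k = k} {x} {y} no-inner =
  atMost-∪ (palindromicDeletion-outer no-inner) (atMost-singleton (k ++ [ y ]) id) (atMost-singleton (x ∷ k) id)

atMost-palindromicDeletion-odd : (m : ℕ) (v : List A) → length v ≡ suc (2 * m) → AtMost (PalindromicDeletion v) 1
atMost-palindromicDeletion-odd zero v |v| = atMost-singleton [] only-[]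
  where
    only-[] : PalindromicDeletion v u → u ≡ []
    only-[] {u = []} _ = refl
    only-[] {u = _ ∷ _} (_ , _ , |u|) = contradiction (trans |u| |v|) λ ()
atMost-palindromicDeletion-odd (suc m) v |v| with split-ends v (trans |v| (cong suc (*-suc 2 m)))
... | _ , [] , _ , _ , ()
... | x , k@(_ ∷ _) , y , refl , |k| = atMost-byCases (x ≡ y)
  (λ where refl → atMost-palindromicDeletion-wrap (λ ()) (atMost-palindromicDeletion-odd m k |k|))
  (λ x≢y → atMost-subsingleton (palindromicDeletion-odd-unique m x≢y |k|))

atMost-palindromicDeletion-even : (m : ℕ) (v : List A) → length v ≡ 2 * m → AtMost (PalindromicDeletion v) 2
atMost-palindromicDeletion-even zero [] _ = atMost-empty λ where (_ , _ , ())
atMost-palindromicDeletion-even (suc m) v |v| with split-ends v (trans |v| (*-suc 2 m))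
... | x , [] , y , refl , _ = atMost-palindromicDeletion-outer {k = []} λ where (_ , _ , ())
... | x , k@(_ ∷ _) , y , refl , |k| = atMost-byCases (x ≡ y)
  (λ where refl → atMost-palindromicDeletion-wrap (λ ()) (atMost-palindromicDeletion-even m k |k|))
  (λ x≢y → atMost-palindromicDeletion-outer {k = k} (λ _ → x≢y))

atMost-SPmember-distinctEnds : {a b : A} → a ≢ b →
  AtMost (PalindromicDeletion (k ++ [ b ])) m → AtMost (PalindromicDeletion (a ∷ k)) n →
  AtMost (SPmember (length k) (a ∷ k ++ [ b ])) (m + n)
atMost-SPmember-distinctEnds {A} {k} {a = a} {b} a≢b = atMost-∪ drop-an-end
  where
    drop-an-end : {u : List A} → SPmember (length k) (a ∷ k ++ [ b ]) u →
      PalindromicDeletion (k ++ [ b ]) u ⊎ PalindromicDeletion (a ∷ k) u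
    drop-an-end (pal , |u| , _ ∷ʳ u⊆) = inj₁ (pal , u⊆ , trans (cong suc |u|) (sym (length-++-[] k)))
    drop-an-end (pal , |u| , refl ∷ u′⊆) with ⊆-++-[]⁻ u′⊆
    ... | inj₁ u′⊆k = inj₂ (pal , refl ∷ u′⊆k , cong suc |u|)
    ... | inj₂ (u″ , refl , _) = contradiction (proj₁ (palindrome-peel a u″ b pal)) a≢b

lemma4p13 : {A : Set} (w : List A) (n : ℕ) (a b : A) →
    length w ≡ n → 2 ≤ n →
    head w ≡ just a → last w ≡ just b → a ≢ b →
    ((m : ℕ) → n ≡ 2 * m → SP≤ (n ∸ 2) w 2) ×
    ((m : ℕ) → n ≡ suc (2 * m) → SP≤ (n ∸ 2) w 4)
lemma4p13 w (suc (suc _)) a b |w| (s≤s (s≤s _)) head≡a last≡b a≢b with split-ends w |w|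
... | x , k , y , refl , refl with just-injective head≡a | just-injective (trans (sym (last-++-[] (x ∷ k))) last≡b)
... | refl | refl = even , odd
  where
    even : (m : ℕ) → suc (suc (length k)) ≡ 2 * m → SP≤ (length k) (a ∷ k ++ [ b ]) 2
    even (suc m) n≡2m = atMost-SPmember-distinctEnds a≢b
      (atMost-palindromicDeletion-odd m (k ++ [ b ]) (trans (length-++-[] k) (cong suc |k|)))
      (atMost-palindromicDeletion-odd m (a ∷ k) (cong suc |k|))
      where
        |k| : length k ≡ 2 * m
        |k| = suc-injective (suc-injective (trans n≡2m (*-suc 2 m)))
    odd : (m : ℕ) → suc (suc (length k)) ≡ suc (2 * m) → SP≤ (length k) (a ∷ k ++ [ b ]) 4
    odd m n≡2m+1 = atMost-SPmember-distinctEnds a≢b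
      (atMost-palindromicDeletion-even m (k ++ [ b ]) (trans (length-++-[] k) (suc-injective n≡2m+1)))
      (atMost-palindromicDeletion-even m (a ∷ k) (suc-injective n≡2m+1))
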